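{- For every positive integer $N$ and every integer $n\ge0$, \[ \alpha_{n}^{(2N)}=i\,(4Nn+2N)!\sum_{l=0}^{2n}(-1)^{l}\frac{\alpha_{2n-l}^{(N)}\,\alpha_{l}^{(N)}}{(4Nn-2Nl+N)!\,(2Nl+N)!}. \]
   Context: For each positive integer $M$, the numbers $\alpha_k^{(M)}$ ($k\ge0$) are defined by the expansion \[ \prod_{j=0}^{M-1}\sinh\!\left(z e^{i j\pi/M}\right)=\sum_{k\ge0}\alpha_{k}^{(M)}\frac{z^{2kM+M}}{(2kM+M)!}. \] -}

module Defs where

open import Level using (Level)
open import Data.Nat using (ℕ; zero; suc; _∸_; _≤_; _<_; _≤?_) renaming (_+_ to _+ℕ_; _*_ to _*ℕ_)
open import Data.Nat.Combinatorics using (_C_)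
open import Data.Product using (_×_)
open import Data.Sum using (_⊎_)
open import Relation.Nullary using (¬_; yes; no)
open import Algebra.Bundles using (CommutativeRing; Semiring)
import Algebra.Definitions.RawSemiring as RS

module _ {c ℓ : Level} (R : CommutativeRing c ℓ) where
  open CommutativeRing R
  open RS (Semiring.rawSemiring semiring) using (_^_) renaming (_×_ to _·_)

  IsIntegralDomain : Set (c Level.⊔ ℓ)
  IsIntegralDomain = (¬ (1# ≈ 0#)) × (∀ a b → a * b ≈ 0# → (a ≈ 0#) ⊎ (b ≈ 0#))

  IsPrimitiveRoot : ℕ → Carrier → Set ℓ
  IsPrimitiveRoot K ζ = (ζ ^ K ≈ 1#) × (∀ m → 0 < m → m < K → ¬ (ζ ^ m ≈ 1#))

  sumR : ℕ → (ℕ → Carrier) → Carrier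
  sumR zero    f = 0#
  sumR (suc n) f = sumR n f + f n

  -- Coefficient (times T!) of z^T in  ∏_{j = s}^{s+k-1} sinh(ω^j z),
  -- with sinh(w) = Σ_m w^(2m+1)/(2m+1)!.  For k = 0 the empty product is 1.
  -- Splitting off the first factor with exponent a = 2m+1:
  --   T! · [z^T] = Σ_a  (T choose a) · ω^(s·a) · (T-a)! · [z^(T-a)] (rest).
  sinhProdCoeff : Carrier → (k s T : ℕ) → Carrier
  sinhProdCoeff ω zero s zero    = 1#
  sinhProdCoeff ω zero s (suc T) = 0#
  sinhProdCoeff ω (suc k) s T =
    sumR (suc T) (λ m → term (2 *ℕ m +ℕ 1))
    where
      term : ℕ → Carrier
      term a with a ≤? T
      ... | yes _ = (T C a) · ((ω ^ (s *ℕ a)) * sinhProdCoeff ω k (suc s) (T ∸ a))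
      ... | no  _ = 0#

  -- α_k^{(M)} where ω plays the role of e^{iπ/M}:
  --   ∏_{j=0}^{M-1} sinh(z ω^j) = Σ_k α_k^{(M)} z^{2kM+M}/(2kM+M)!
  α : (ω : Carrier) (M k : ℕ) → Carrier
  α ω M k = sinhProdCoeff ω M 0 (2 *ℕ k *ℕ M +ℕ M)

  powR : Carrier → ℕ → Carrier
  powR = _^_

  natMul : ℕ → Carrier → Carrier
  natMul = _·_

module Submission where

-- Put ω = ζ², so that α^(N) are the coefficients of A(z) = ∏_{j<N} sinh (ω^j z), and α^(2N) those of
-- ∏_{j<2N} sinh (ζ^j z). Splitting the latter product by the parity of j gives A(z) · A(ζ z). As ω^N = -1,
-- A(ω z) = - A(z), so (ω^T + 1) · A_T = 0; in an integral domain A_T therefore vanishes unless ζ^(2T) = -1,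
-- i.e. unless T ≡ N (mod 2N). In the binomial convolution computing the coefficient of A(z) · A(ζ z) only
-- the terms with both indices ≡ N (mod 2N) survive, and ζ^(2N d + N) = (-1)^d ζ^N supplies the sign.

open import Defs
open import Level using (Level)
open import Data.Nat using (ℕ; zero; suc; _∸_; _<_; _≤_; _≤?_; parity)
  renaming (_+_ to _+ℕ_; _*_ to _*ℕ_)
import Data.Nat.Properties as ℕ
open import Data.Nat.Combinatorics using (_C_; k>n⇒nCk≡0; nCk+nC[k+1]≡[n+1]C[k+1])
open import Data.Parity.Base using (Parity; 0ℙ; 1ℙ) renaming (_+_ to _+ℙ_)
import Data.Parity.Properties as ℙ
open import Data.Nat.Tactic.RingSolver using (solve-∀)
open import Data.Product using (proj₁; proj₂)
open import Data.Sum using (_⊎_; inj₁; inj₂; [_,_]′)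
open import Data.Empty using (⊥-elim)
open import Relation.Nullary using (¬_; yes; no)
open import Function using (id)
open import Relation.Binary.PropositionalEquality as P using (_≡_; _≢_)
open import Algebra.Bundles using (CommutativeRing; Semiring; CommutativeSemigroup)
open import Algebra.Structures using (IsCommutativeSemigroup)
open import Relation.Binary.Structures using (IsEquivalence)
open import Relation.Binary.Bundles using (Setoid)
import Algebra.Definitions.RawSemiring as RawSemiring

parity-even : ∀ m → parity (2 *ℕ m) ≡ 0ℙ
parity-even m = ℙ.*-homo-* 2 m

parity-odd : ∀ m → parity (2 *ℕ m +ℕ 1) ≡ 1ℙ
parity-odd m = P.trans (ℙ.+-homo-+ (2 *ℕ m) 1) (P.cong (_+ℙ 1ℙ) (parity-even m))

parity-complement : ∀ {q d n} → q +ℕ d ≡ 2 *ℕ n → parity d ≡ parity q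
parity-complement {q} {d} {n} q+d≡2n = ℙ.+-cancelˡ-≡ (parity q) (parity d) (parity q)
  (P.trans (P.sym (ℙ.+-homo-+ q d))
  (P.trans (P.cong parity q+d≡2n)
  (P.trans (parity-even n) (P.sym (ℙ.p+p≡0ℙ (parity q))))))

n<2*n : ∀ {n} → 0 < n → n < 2 *ℕ n
n<2*n {n} 0<n = ℕ.m<m+n n (ℕ.<-≤-trans 0<n (ℕ.m≤m+n n 0))

module _ {c ℓ : Level} (R : CommutativeRing c ℓ) where
  open CommutativeRing R
  open RawSemiring (Semiring.rawSemiring semiring) using (_^_; _×_)
  open import Algebra.Properties.Semiring.Exp semiring using (^-congˡ; ^-congʳ; ^-homo-*; ^-assocʳ)
  open import Algebra.Properties.Ring ring using (-1*x≈-x; -‿involutive; [y-z]x≈yx-zx; x[y-z]≈xy-xz)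
  open import Algebra.Properties.Group +-group using (inverseˡ-unique; x∙y⁻¹≈ε⇒x≈y; x≈y⇒x∙y⁻¹≈ε)
  open import Algebra.Properties.Semiring.Mult semiring using (×-cong; ×-congʳ; ×-congˡ; ×-homo-+; ×-comm-*)
  open import Algebra.Properties.CommutativeMonoid.Mult +-commutativeMonoid using (×-distrib-+)
  open import Algebra.Properties.CommutativeSemigroup +-commutativeSemigroup
    using (x∙yz≈y∙xz) renaming (interchange to +-interchange)
  open import Algebra.Properties.CommutativeSemigroup *-commutativeSemigroup
    using () renaming (interchange to *-interchange)

  module _ where
    open import Relation.Binary.Reasoning.Setoid setoid

    -- Finite sums and powers

    sum : ℕ → (ℕ → Carrier) → Carrier
    sum = sumR R

    sum-cong : ∀ n {f g} → (∀ m → m < n → f m ≈ g m) → sum n f ≈ sum n g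
    sum-cong zero    f≈g = refl
    sum-cong (suc n) f≈g = +-cong (sum-cong n (λ m m<n → f≈g m (ℕ.m<n⇒m<1+n m<n))) (f≈g n (ℕ.n<1+n n))

    sum-zero : ∀ n {f} → (∀ m → m < n → f m ≈ 0#) → sum n f ≈ 0#
    sum-zero zero    f≈0 = refl
    sum-zero (suc n) f≈0 =
      trans (+-cong (sum-zero n (λ m m<n → f≈0 m (ℕ.m<n⇒m<1+n m<n))) (f≈0 n (ℕ.n<1+n n))) (+-identityˡ 0#)

    sum-distrib-+ : ∀ n f g → sum n (λ m → f m + g m) ≈ sum n f + sum n g
    sum-distrib-+ zero    f g = sym (+-identityˡ 0#)
    sum-distrib-+ (suc n) f g = trans (+-congʳ (sum-distrib-+ n f g)) (+-interchange _ _ _ _)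

    *-distribˡ-sum : ∀ n x f → x * sum n f ≈ sum n (λ m → x * f m)
    *-distribˡ-sum zero    x f = zeroʳ x
    *-distribˡ-sum (suc n) x f = trans (distribˡ x _ _) (+-congʳ (*-distribˡ-sum n x f))

    sum-suc : ∀ n f → sum (suc n) f ≈ f 0 + sum n (λ m → f (suc m))
    sum-suc zero    f = trans (+-identityˡ _) (sym (+-identityʳ _))
    sum-suc (suc n) f = trans (+-congʳ (sum-suc n f)) (+-assoc _ _ _)

    sum-+ : ∀ m n f → sum (m +ℕ n) f ≈ sum m f + sum n (λ i → f (m +ℕ i))
    sum-+ m zero    f rewrite ℕ.+-identityʳ m = sym (+-identityʳ _)
    sum-+ m (suc n) f rewrite ℕ.+-suc m n = trans (+-congʳ (sum-+ m n f)) (+-assoc _ _ _)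

    sum-* : ∀ K B f → sum (K *ℕ B) f ≈ sum K (λ q → sum B (λ r → f (q *ℕ B +ℕ r)))
    sum-* zero    B f = refl
    sum-* (suc K) B f rewrite ℕ.+-comm B (K *ℕ B) = trans (sum-+ (K *ℕ B) B f) (+-congʳ (sum-* K B f))

    sum-pairs : ∀ n f → sum (2 *ℕ n) f ≈ sum n (λ m → f (2 *ℕ m) + f (suc (2 *ℕ m)))
    sum-pairs zero    f = refl
    sum-pairs (suc n) f rewrite ℕ.+-suc n (n +ℕ 0) = trans (+-assoc _ _ _) (+-congʳ (sum-pairs n f))

    sum-extend : ∀ n k f → (∀ m → n ≤ m → f m ≈ 0#) → sum (n +ℕ k) f ≈ sum n f
    sum-extend n k f f≈0 =
      trans (sum-+ n k f) (trans (+-congˡ (sum-zero k (λ m _ → f≈0 (n +ℕ m) (ℕ.m≤m+n n m)))) (+-identityʳ _))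

    sum-singleton : ∀ n f j → j < n → (∀ r → r < n → r ≢ j → f r ≈ 0#) → sum n f ≈ f j
    sum-singleton (suc n) f j j<1+n f≈0 with j ℕ.≟ n
    ... | yes P.refl =
      trans (+-congʳ (sum-zero n (λ m m<n → f≈0 m (ℕ.m<n⇒m<1+n m<n) (ℕ.<⇒≢ m<n)))) (+-identityˡ _)
    ... | no j≢n = trans (+-cong (sum-singleton n f j (ℕ.≤∧≢⇒< (ℕ.≤-pred j<1+n) j≢n)
                                                    (λ r r<n → f≈0 r (ℕ.m<n⇒m<1+n r<n)))
                                 (f≈0 n (ℕ.n<1+n n) (λ n≡j → j≢n (P.sym n≡j))))
                         (+-identityʳ _)

    ×-zeroʳ : ∀ n → n × 0# ≈ 0#
    ×-zeroʳ n = begin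
      n × 0#         ≈⟨ ×-congʳ n (zeroˡ 0#) ⟨
      n × (0# * 0#)  ≈⟨ ×-comm-* n 0# 0# ⟨
      0# * (n × 0#)  ≈⟨ zeroˡ _ ⟩
      0#             ∎

    sign : Parity → Carrier
    sign 0ℙ = 1#
    sign 1ℙ = - 1#

    -1*-1≈1 : - 1# * - 1# ≈ 1#
    -1*-1≈1 = trans (-1*x≈-x (- 1#)) (-‿involutive 1#)

    -1^n≈sign : ∀ n → (- 1#) ^ n ≈ sign (parity n)
    -1^n≈sign zero          = refl
    -1^n≈sign (suc zero)    = *-identityʳ (- 1#)
    -1^n≈sign (suc (suc n)) = begin
      - 1# * (- 1# * (- 1#) ^ n)  ≈⟨ *-assoc _ _ _ ⟨
      - 1# * - 1# * (- 1#) ^ n    ≈⟨ *-congʳ -1*-1≈1 ⟩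
      1# * (- 1#) ^ n             ≈⟨ *-identityˡ _ ⟩
      (- 1#) ^ n                  ≈⟨ -1^n≈sign n ⟩
      sign (parity n)             ∎

    ^-square : ∀ x n → (x * x) ^ n ≈ x ^ (2 *ℕ n)
    ^-square x n = trans (^-congˡ n (*-congˡ (sym (*-identityʳ x)))) (^-assocʳ x 2 n)

    ^-periodic : ∀ {ζ K} → ζ ^ K ≈ 1# → ∀ q e → ζ ^ (q *ℕ K +ℕ e) ≈ ζ ^ e
    ^-periodic         ζ^K≈1 zero    e = refl
    ^-periodic {ζ} {K} ζ^K≈1 (suc q) e = begin
      ζ ^ (K +ℕ q *ℕ K +ℕ e)    ≡⟨ P.cong (ζ ^_) (ℕ.+-assoc K (q *ℕ K) e) ⟩
      ζ ^ (K +ℕ (q *ℕ K +ℕ e))  ≈⟨ ^-homo-* ζ K _ ⟩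
      ζ ^ K * ζ ^ (q *ℕ K +ℕ e) ≈⟨ *-cong ζ^K≈1 (^-periodic ζ^K≈1 q e) ⟩
      1# * ζ ^ e                ≈⟨ *-identityˡ _ ⟩
      ζ ^ e                     ∎

    -- Exponential generating functions

    k>n⇒[nCk]×x≈0 : ∀ {T a} x → T < a → (T C a) × x ≈ 0#
    k>n⇒[nCk]×x≈0 x T<a rewrite k>n⇒nCk≡0 T<a = refl

    -- A sequence f stands for the series Σ_T f T z^T / T!; ⋆ is the product, shift the derivative and
    -- twist x the substitution z ↦ x z.
    Seq : Set c
    Seq = ℕ → Carrier

    infix 4 _≋_
    _≋_ : Seq → Seq → Set ℓ
    f ≋ g = ∀ T → f T ≈ g T

    ≋-isEquivalence : IsEquivalence _≋_
    ≋-isEquivalence = record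
      { refl  = λ T → refl
      ; sym   = λ f≋g T → sym (f≋g T)
      ; trans = λ f≋g g≋h T → trans (f≋g T) (g≋h T)
      }

    ≋-setoid : Setoid c ℓ
    ≋-setoid = record { isEquivalence = ≋-isEquivalence }

    open IsEquivalence ≋-isEquivalence public using () renaming (sym to ≋-sym; trans to ≋-trans)

    shift : Seq → Seq
    shift f T = f (suc T)

    twist : Carrier → Seq → Seq
    twist x f T = x ^ T * f T

    twist-cong : ∀ x {f g} → f ≋ g → twist x f ≋ twist x g
    twist-cong x f≋g T = *-congˡ (f≋g T)

    infixl 6 _⊕_
    _⊕_ : Seq → Seq → Seq
    (f ⊕ g) T = f T + g T

    δ : Seq
    δ zero    = 1#
    δ (suc _) = 0#

    infixl 7 _⋆_
    _⋆_ : Seq → Seq → Seq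
    (f ⋆ g) T = sum (suc T) (λ a → (T C a) × (f a * g (T ∸ a)))

    ⋆-cong : ∀ {f f′ g g′} → f ≋ f′ → g ≋ g′ → f ⋆ g ≋ f′ ⋆ g′
    ⋆-cong f≋f′ g≋g′ T = sum-cong (suc T) (λ a _ → ×-congʳ (T C a) (*-cong (f≋f′ a) (g≋g′ (T ∸ a))))

    ⋆-congˡ : ∀ f {g g′} → g ≋ g′ → f ⋆ g ≋ f ⋆ g′
    ⋆-congˡ f g≋g′ = ⋆-cong {f = f} (λ _ → refl) g≋g′

    ⋆-congʳ : ∀ g {f f′} → f ≋ f′ → f ⋆ g ≋ f′ ⋆ g
    ⋆-congʳ g f≋f′ = ⋆-cong {g = g} f≋f′ (λ _ → refl)

    ⋆-at-0 : ∀ f g → (f ⋆ g) 0 ≈ f 0 * g 0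
    ⋆-at-0 f g = trans (+-identityˡ _) (+-identityʳ _)

    ⋆-leibniz : ∀ f g → shift (f ⋆ g) ≋ shift f ⋆ g ⊕ f ⋆ shift g
    ⋆-leibniz f g T = begin
      (f ⋆ g) (suc T)                                           ≈⟨ sum-suc (suc T) _ ⟩
      h₀ + sum (suc T) (λ a → (suc T C suc a) × u a)             ≈⟨ +-congˡ (sum-cong (suc T) (λ a _ → pascal a)) ⟩
      h₀ + sum (suc T) (λ a → (T C a) × u a + (T C suc a) × u a) ≈⟨ +-congˡ (sum-distrib-+ (suc T) _ _) ⟩
      h₀ + ((shift f ⋆ g) T + lower)                             ≈⟨ x∙yz≈y∙xz _ _ _ ⟩
      (shift f ⋆ g) T + (h₀ + lower)                             ≈⟨ +-congˡ f⋆shift-g ⟨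
      (shift f ⋆ g) T + (f ⋆ shift g) T                          ∎
      where
      u : ℕ → Carrier
      u a = f (suc a) * g (T ∸ a)
      h₀ lower : Carrier
      h₀    = 1 × (f 0 * g (suc T))
      lower = sum (suc T) (λ a → (T C suc a) × u a)
      pascal : ∀ a → (suc T C suc a) × u a ≈ (T C a) × u a + (T C suc a) × u a
      pascal a = trans (×-congˡ (P.sym (nCk+nC[k+1]≡[n+1]C[k+1] T a))) (×-homo-+ (u a) (T C a) (T C suc a))
      f⋆shift-g : (f ⋆ shift g) T ≈ h₀ + lower
      f⋆shift-g = begin
        (f ⋆ shift g) T
          ≈⟨ sum-suc T _ ⟩
        h₀ + sum T (λ a → (T C suc a) × (f (suc a) * g (suc (T ∸ suc a))))
          ≈⟨ +-congˡ (sum-cong T (λ a a<T → ×-congʳ (T C suc a)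
                                     (*-congˡ (reflexive (P.cong g (P.sym (ℕ.+-∸-assoc 1 a<T))))))) ⟩
        h₀ + sum T (λ a → (T C suc a) × u a)
          ≈⟨ +-congˡ (trans (+-congˡ (k>n⇒[nCk]×x≈0 (u T) (ℕ.n<1+n T))) (+-identityʳ _)) ⟨
        h₀ + lower
          ∎

    ⋆-comm : ∀ f g → f ⋆ g ≋ g ⋆ f
    ⋆-comm f g zero    = trans (⋆-at-0 f g) (trans (*-comm _ _) (sym (⋆-at-0 g f)))
    ⋆-comm f g (suc T) = begin
      (f ⋆ g) (suc T)                    ≈⟨ ⋆-leibniz f g T ⟩
      (shift f ⋆ g) T + (f ⋆ shift g) T  ≈⟨ +-cong (⋆-comm (shift f) g T) (⋆-comm f (shift g) T) ⟩
      (g ⋆ shift f) T + (shift g ⋆ f) T  ≈⟨ +-comm _ _ ⟩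
      (shift g ⋆ f) T + (g ⋆ shift f) T  ≈⟨ ⋆-leibniz g f T ⟨
      (g ⋆ f) (suc T)                    ∎

    ⋆-distribʳ-⊕ : ∀ f g h → (f ⊕ g) ⋆ h ≋ f ⋆ h ⊕ g ⋆ h
    ⋆-distribʳ-⊕ f g h T = trans
      (sum-cong (suc T) (λ a _ → trans (×-congʳ (T C a) (distribʳ _ _ _)) (×-distrib-+ _ _ (T C a))))
      (sum-distrib-+ (suc T) _ _)

    ⋆-distribˡ-⊕ : ∀ f g h → f ⋆ (g ⊕ h) ≋ f ⋆ g ⊕ f ⋆ h
    ⋆-distribˡ-⊕ f g h T = trans
      (sum-cong (suc T) (λ a _ → trans (×-congʳ (T C a) (distribˡ _ _ _)) (×-distrib-+ _ _ (T C a))))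
      (sum-distrib-+ (suc T) _ _)

    ⋆-assoc : ∀ f g h → (f ⋆ g) ⋆ h ≋ f ⋆ (g ⋆ h)
    ⋆-assoc f g h zero    = begin
      ((f ⋆ g) ⋆ h) 0   ≈⟨ ⋆-at-0 (f ⋆ g) h ⟩
      (f ⋆ g) 0 * h 0   ≈⟨ *-congʳ (⋆-at-0 f g) ⟩
      f 0 * g 0 * h 0   ≈⟨ *-assoc _ _ _ ⟩
      f 0 * (g 0 * h 0) ≈⟨ *-congˡ (⋆-at-0 g h) ⟨
      f 0 * (g ⋆ h) 0   ≈⟨ ⋆-at-0 f (g ⋆ h) ⟨
      (f ⋆ (g ⋆ h)) 0   ∎
    ⋆-assoc f g h (suc T) = begin
      ((f ⋆ g) ⋆ h) (suc T)
        ≈⟨ ⋆-leibniz (f ⋆ g) h T ⟩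
      (shift (f ⋆ g) ⋆ h) T + ((f ⋆ g) ⋆ shift h) T
        ≈⟨ +-congʳ (trans (⋆-congʳ h (⋆-leibniz f g) T) (⋆-distribʳ-⊕ (shift f ⋆ g) (f ⋆ shift g) h T)) ⟩
      ((shift f ⋆ g) ⋆ h) T + ((f ⋆ shift g) ⋆ h) T + ((f ⋆ g) ⋆ shift h) T
        ≈⟨ +-cong (+-cong (⋆-assoc (shift f) g h T) (⋆-assoc f (shift g) h T)) (⋆-assoc f g (shift h) T) ⟩
      (shift f ⋆ (g ⋆ h)) T + (f ⋆ (shift g ⋆ h)) T + (f ⋆ (g ⋆ shift h)) T
        ≈⟨ +-assoc _ _ _ ⟩
      (shift f ⋆ (g ⋆ h)) T + ((f ⋆ (shift g ⋆ h)) T + (f ⋆ (g ⋆ shift h)) T)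
        ≈⟨ +-congˡ (trans (⋆-congˡ f (⋆-leibniz g h) T) (⋆-distribˡ-⊕ f (shift g ⋆ h) (g ⋆ shift h) T)) ⟨
      (shift f ⋆ (g ⋆ h)) T + (f ⋆ shift (g ⋆ h)) T
        ≈⟨ ⋆-leibniz f (g ⋆ h) T ⟨
      (f ⋆ (g ⋆ h)) (suc T)
        ∎

    ⋆-isCommutativeSemigroup : IsCommutativeSemigroup _≋_ _⋆_
    ⋆-isCommutativeSemigroup = record
      { isSemigroup = record
        { isMagma = record { isEquivalence = ≋-isEquivalence ; ∙-cong = ⋆-cong }
        ; assoc   = ⋆-assoc
        }
      ; comm = ⋆-comm
      }

    ⋆-commutativeSemigroup : CommutativeSemigroup c ℓ
    ⋆-commutativeSemigroup = record { isCommutativeSemigroup = ⋆-isCommutativeSemigroup }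

    ⋆-identityˡ : ∀ g → δ ⋆ g ≋ g
    ⋆-identityˡ g T = begin
      (δ ⋆ g) T
        ≈⟨ sum-suc T _ ⟩
      1 × (1# * g T) + sum T (λ a → (T C suc a) × (0# * g (T ∸ suc a)))
        ≈⟨ +-cong (trans (+-identityʳ _) (*-identityˡ _))
                  (sum-zero T (λ a _ → trans (×-congʳ (T C suc a) (zeroˡ _)) (×-zeroʳ (T C suc a)))) ⟩
      g T + 0#
        ≈⟨ +-identityʳ _ ⟩
      g T ∎

    ⋆-scaleˡ : ∀ x f g → (λ a → x * f a) ⋆ g ≋ (λ T → x * (f ⋆ g) T)
    ⋆-scaleˡ x f g T = trans
      (sum-cong (suc T) (λ a _ → trans (×-congʳ (T C a) (*-assoc x _ _)) (sym (×-comm-* (T C a) x _))))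
      (sym (*-distribˡ-sum (suc T) x _))

    twist-δ : ∀ x → twist x δ ≋ δ
    twist-δ x zero    = *-identityʳ 1#
    twist-δ x (suc T) = zeroʳ _

    twist-distrib-⋆ : ∀ x f g → twist x (f ⋆ g) ≋ twist x f ⋆ twist x g
    twist-distrib-⋆ x f g T = trans (*-distribˡ-sum (suc T) (x ^ T) _) (sum-cong (suc T) twist-term)
      where
      twist-term : ∀ a → a < suc T →
        x ^ T * ((T C a) × (f a * g (T ∸ a))) ≈ (T C a) × ((x ^ a * f a) * (x ^ (T ∸ a) * g (T ∸ a)))
      twist-term a a<1+T = begin
        x ^ T * ((T C a) × (f a * g (T ∸ a)))                   ≈⟨ ×-comm-* (T C a) _ _ ⟩
        (T C a) × (x ^ T * (f a * g (T ∸ a)))                   ≈⟨ ×-congʳ (T C a) (*-congʳ x^T-split) ⟩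
        (T C a) × ((x ^ a * x ^ (T ∸ a)) * (f a * g (T ∸ a)))   ≈⟨ ×-congʳ (T C a) (*-interchange _ _ _ _) ⟩
        (T C a) × ((x ^ a * f a) * (x ^ (T ∸ a) * g (T ∸ a)))   ∎
        where
        x^T-split : x ^ T ≈ x ^ a * x ^ (T ∸ a)
        x^T-split = trans (^-congʳ x (P.sym (ℕ.m+[n∸m]≡n (ℕ.≤-pred a<1+T)))) (^-homo-* x a (T ∸ a))

    -- Products of sinh

    -- sinh (ω^s z) = Σ_{a odd} ω^(s a) z^a / a!
    sinhCoeff : Carrier → ℕ → Seq
    sinhCoeff ω s a with parity a
    ... | 0ℙ = 0#
    ... | 1ℙ = ω ^ (s *ℕ a)

    sinhCoeff-even : ∀ ω s m → sinhCoeff ω s (2 *ℕ m) ≈ 0#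
    sinhCoeff-even ω s m with parity (2 *ℕ m) | parity-even m
    ... | _ | P.refl = refl

    sinhCoeff-odd : ∀ ω s m → sinhCoeff ω s (2 *ℕ m +ℕ 1) ≈ ω ^ (s *ℕ (2 *ℕ m +ℕ 1))
    sinhCoeff-odd ω s m with parity (2 *ℕ m +ℕ 1) | parity-odd m
    ... | _ | P.refl = refl

    twist-sinhCoeff : ∀ ω s → twist ω (sinhCoeff ω s) ≋ sinhCoeff ω (suc s)
    twist-sinhCoeff ω s a with parity a
    ... | 0ℙ = zeroʳ _
    ... | 1ℙ = sym (^-homo-* ω a (s *ℕ a))

    sinhCoeff-square : ∀ ζ t → sinhCoeff ζ (2 *ℕ t) ≋ sinhCoeff (ζ * ζ) t
    sinhCoeff-square ζ t a with parity a
    ... | 0ℙ = refl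
    ... | 1ℙ = sym (trans (^-square ζ (t *ℕ a)) (^-congʳ ζ (P.sym (ℕ.*-assoc 2 t a))))

    sinhCoeff-antiperiodic : ∀ {ω K} → ω ^ K ≈ - 1# → sinhCoeff ω K ≋ (λ a → - 1# * sinhCoeff ω 0 a)
    sinhCoeff-antiperiodic {ω} {K} ω^K≈-1 a with parity a in odd
    ... | 0ℙ = sym (zeroʳ _)
    ... | 1ℙ = begin
      ω ^ (K *ℕ a)    ≈⟨ ^-assocʳ ω K a ⟨
      (ω ^ K) ^ a     ≈⟨ ^-congˡ a ω^K≈-1 ⟩
      (- 1#) ^ a      ≈⟨ -1^n≈sign a ⟩
      sign (parity a) ≡⟨ P.cong sign odd ⟩
      - 1#            ≈⟨ *-identityʳ _ ⟨
      - 1# * 1#       ∎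

    -- sinhProdCoeff ω (suc k) s T sums a where-bound function of Defs; summandOf gets hold of it by
    -- unification, so that its case split on (a ≤? T) can be replayed with `with`.
    summandOf : ∀ n {F : ℕ → Carrier} {x} → x ≡ sum n F → ℕ → Carrier
    summandOf _ {F} _ = F

    sinhProdCoeff-zero : ∀ ω s → sinhProdCoeff R ω 0 s ≋ δ
    sinhProdCoeff-zero ω s zero    = refl
    sinhProdCoeff-zero ω s (suc T) = refl

    sinhProdCoeff-suc : ∀ ω k s → sinhProdCoeff R ω (suc k) s ≋ sinhCoeff ω s ⋆ sinhProdCoeff R ω k (suc s)
    sinhProdCoeff-suc ω k s T = begin
      sum (suc T) F
        ≈⟨ sum-cong (suc T) (λ m _ → trans (odd-term m) (reflexive (P.cong g (ℕ.+-comm (2 *ℕ m) 1)))) ⟩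
      sum (suc T) (λ m → g (suc (2 *ℕ m)))
        ≈⟨ sum-cong (suc T) (λ m _ → trans (+-congʳ (even-term m)) (+-identityˡ _)) ⟨
      sum (suc T) (λ m → g (2 *ℕ m) + g (suc (2 *ℕ m)))
        ≈⟨ sum-pairs (suc T) g ⟨
      sum (2 *ℕ suc T) g
        ≈⟨ sum-extend (suc T) (suc T +ℕ 0) g (λ a T<a → k>n⇒[nCk]×x≈0 _ T<a) ⟩
      sum (suc T) g
        ∎
      where
      F g : ℕ → Carrier
      F = summandOf (suc T) (P.refl {x = sinhProdCoeff R ω (suc k) s T})
      g a = (T C a) × (sinhCoeff ω s a * sinhProdCoeff R ω k (suc s) (T ∸ a))
      even-term : ∀ m → g (2 *ℕ m) ≈ 0#
      even-term m = trans (×-congʳ (T C (2 *ℕ m)) (trans (*-congʳ (sinhCoeff-even ω s m)) (zeroˡ _)))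
                          (×-zeroʳ (T C (2 *ℕ m)))
      odd-term : ∀ m → F m ≈ g (2 *ℕ m +ℕ 1)
      odd-term m with 2 *ℕ m +ℕ 1 ≤? T
      ... | yes _     = ×-congʳ (T C (2 *ℕ m +ℕ 1)) (*-congʳ (sym (sinhCoeff-odd ω s m)))
      ... | no 2m+1≰T = sym (k>n⇒[nCk]×x≈0 _ (ℕ.≰⇒> 2m+1≰T))

  module _ where
    open import Relation.Binary.Reasoning.Setoid ≋-setoid
    open import Algebra.Properties.CommutativeSemigroup ⋆-commutativeSemigroup
      using () renaming (interchange to ⋆-interchange)

    twist-sinhProdCoeff : ∀ ω k s → twist ω (sinhProdCoeff R ω k s) ≋ sinhProdCoeff R ω k (suc s)
    twist-sinhProdCoeff ω zero    s = begin
      twist ω (sinhProdCoeff R ω 0 s) ≈⟨ twist-cong ω (sinhProdCoeff-zero ω s) ⟩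
      twist ω δ                       ≈⟨ twist-δ ω ⟩
      δ                               ≈⟨ sinhProdCoeff-zero ω (suc s) ⟨
      sinhProdCoeff R ω 0 (suc s)     ∎
    twist-sinhProdCoeff ω (suc k) s = begin
      twist ω (sinhProdCoeff R ω (suc k) s)
        ≈⟨ twist-cong ω (sinhProdCoeff-suc ω k s) ⟩
      twist ω (sinhCoeff ω s ⋆ sinhProdCoeff R ω k (suc s))
        ≈⟨ twist-distrib-⋆ ω (sinhCoeff ω s) (sinhProdCoeff R ω k (suc s)) ⟩
      twist ω (sinhCoeff ω s) ⋆ twist ω (sinhProdCoeff R ω k (suc s))
        ≈⟨ ⋆-cong (twist-sinhCoeff ω s) (twist-sinhProdCoeff ω k (suc s)) ⟩
      sinhCoeff ω (suc s) ⋆ sinhProdCoeff R ω k (suc (suc s))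
        ≈⟨ sinhProdCoeff-suc ω k (suc s) ⟨
      sinhProdCoeff R ω (suc k) (suc s)
        ∎

    sinhProdCoeff-snoc : ∀ ω k s → sinhProdCoeff R ω (suc k) s ≋ sinhProdCoeff R ω k s ⋆ sinhCoeff ω (s +ℕ k)
    sinhProdCoeff-snoc ω zero    s = begin
      sinhProdCoeff R ω 1 s                  ≈⟨ sinhProdCoeff-suc ω 0 s ⟩
      sinhCoeff ω s ⋆ sinhProdCoeff R ω 0 (suc s) ≈⟨ ⋆-congˡ (sinhCoeff ω s) (sinhProdCoeff-zero ω (suc s)) ⟩
      sinhCoeff ω s ⋆ δ                      ≈⟨ ⋆-comm _ _ ⟩
      δ ⋆ sinhCoeff ω s                      ≈⟨ ⋆-congʳ (sinhCoeff ω s) (sinhProdCoeff-zero ω s) ⟨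
      sinhProdCoeff R ω 0 s ⋆ sinhCoeff ω s  ≡⟨ P.cong (λ j → sinhProdCoeff R ω 0 s ⋆ sinhCoeff ω j) (ℕ.+-identityʳ s) ⟨
      sinhProdCoeff R ω 0 s ⋆ sinhCoeff ω (s +ℕ 0) ∎
    sinhProdCoeff-snoc ω (suc k) s = begin
      sinhProdCoeff R ω (suc (suc k)) s
        ≈⟨ sinhProdCoeff-suc ω (suc k) s ⟩
      sinhCoeff ω s ⋆ sinhProdCoeff R ω (suc k) (suc s)
        ≈⟨ ⋆-congˡ (sinhCoeff ω s) (sinhProdCoeff-snoc ω k (suc s)) ⟩
      sinhCoeff ω s ⋆ (sinhProdCoeff R ω k (suc s) ⋆ sinhCoeff ω (suc s +ℕ k))
        ≈⟨ ⋆-assoc (sinhCoeff ω s) (sinhProdCoeff R ω k (suc s)) (sinhCoeff ω (suc s +ℕ k)) ⟨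
      sinhCoeff ω s ⋆ sinhProdCoeff R ω k (suc s) ⋆ sinhCoeff ω (suc s +ℕ k)
        ≈⟨ ⋆-congʳ (sinhCoeff ω (suc s +ℕ k)) (sinhProdCoeff-suc ω k s) ⟨
      sinhProdCoeff R ω (suc k) s ⋆ sinhCoeff ω (suc s +ℕ k)
        ≡⟨ P.cong (λ j → sinhProdCoeff R ω (suc k) s ⋆ sinhCoeff ω j) (ℕ.+-suc s k) ⟨
      sinhProdCoeff R ω (suc k) s ⋆ sinhCoeff ω (s +ℕ suc k)
        ∎

    -- sinh (ω^K z) = - sinh z, so moving the window of factors up by one flips the sign of the product.
    twist-sinhProdCoeff-antiperiodic : ∀ {ω K} → ω ^ K ≈ - 1# → 0 < K →
      twist ω (sinhProdCoeff R ω K 0) ≋ (λ T → - 1# * sinhProdCoeff R ω K 0 T)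
    twist-sinhProdCoeff-antiperiodic {ω} {suc M} ω^K≈-1 _ = begin
      twist ω (sinhProdCoeff R ω (suc M) 0)
        ≈⟨ twist-sinhProdCoeff ω (suc M) 0 ⟩
      sinhProdCoeff R ω (suc M) 1
        ≈⟨ sinhProdCoeff-snoc ω M 1 ⟩
      sinhProdCoeff R ω M 1 ⋆ sinhCoeff ω (suc M)
        ≈⟨ ⋆-congˡ (sinhProdCoeff R ω M 1) (sinhCoeff-antiperiodic ω^K≈-1) ⟩
      sinhProdCoeff R ω M 1 ⋆ (λ a → - 1# * sinhCoeff ω 0 a)
        ≈⟨ ⋆-comm _ _ ⟩
      (λ a → - 1# * sinhCoeff ω 0 a) ⋆ sinhProdCoeff R ω M 1
        ≈⟨ ⋆-scaleˡ (- 1#) (sinhCoeff ω 0) (sinhProdCoeff R ω M 1) ⟩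
      (λ T → - 1# * (sinhCoeff ω 0 ⋆ sinhProdCoeff R ω M 1) T)
        ≈⟨ (λ T → *-congˡ (sinhProdCoeff-suc ω M 0 T)) ⟨
      (λ T → - 1# * sinhProdCoeff R ω (suc M) 0 T)
        ∎

    -- The factors sinh (ζ^j z) with odd j are those with even j, evaluated at ζ z.
    sinhProdCoeff-even-odd : ∀ ζ k t →
      sinhProdCoeff R ζ (2 *ℕ k) (2 *ℕ t) ≋ sinhProdCoeff R (ζ * ζ) k t ⋆ twist ζ (sinhProdCoeff R (ζ * ζ) k t)
    sinhProdCoeff-even-odd ζ zero    t = begin
      sinhProdCoeff R ζ 0 (2 *ℕ t)  ≈⟨ sinhProdCoeff-zero ζ (2 *ℕ t) ⟩
      δ                             ≈⟨ ⋆-identityˡ δ ⟨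
      δ ⋆ δ                         ≈⟨ ⋆-cong (≋-sym P₀≋δ) (≋-trans (≋-sym (twist-δ ζ)) (twist-cong ζ (≋-sym P₀≋δ))) ⟩
      P₀ ⋆ twist ζ P₀               ∎
      where
      P₀ : Seq
      P₀ = sinhProdCoeff R (ζ * ζ) 0 t
      P₀≋δ : P₀ ≋ δ
      P₀≋δ = sinhProdCoeff-zero (ζ * ζ) t
    sinhProdCoeff-even-odd ζ (suc k) t = begin
      sinhProdCoeff R ζ (2 *ℕ suc k) (2 *ℕ t)
        ≡⟨ P.cong (λ j → sinhProdCoeff R ζ j (2 *ℕ t)) (ℕ.*-suc 2 k) ⟩
      sinhProdCoeff R ζ (suc (suc (2 *ℕ k))) (2 *ℕ t)
        ≈⟨ sinhProdCoeff-suc ζ (suc (2 *ℕ k)) (2 *ℕ t) ⟩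
      sinhCoeff ζ (2 *ℕ t) ⋆ sinhProdCoeff R ζ (suc (2 *ℕ k)) (suc (2 *ℕ t))
        ≈⟨ ⋆-congˡ (sinhCoeff ζ (2 *ℕ t)) (sinhProdCoeff-suc ζ (2 *ℕ k) (suc (2 *ℕ t))) ⟩
      sinhCoeff ζ (2 *ℕ t) ⋆ (sinhCoeff ζ (suc (2 *ℕ t)) ⋆ sinhProdCoeff R ζ (2 *ℕ k) (2 +ℕ 2 *ℕ t))
        ≡⟨ P.cong (λ j → sinhCoeff ζ (2 *ℕ t) ⋆ (sinhCoeff ζ (suc (2 *ℕ t)) ⋆ sinhProdCoeff R ζ (2 *ℕ k) j))
                  (ℕ.*-suc 2 t) ⟨
      sinhCoeff ζ (2 *ℕ t) ⋆ (sinhCoeff ζ (suc (2 *ℕ t)) ⋆ sinhProdCoeff R ζ (2 *ℕ k) (2 *ℕ suc t))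
        ≈⟨ ⋆-cong (sinhCoeff-square ζ t) (⋆-cong odd-factors (sinhProdCoeff-even-odd ζ k (suc t))) ⟩
      S ⋆ (twist ζ S ⋆ (X ⋆ twist ζ X))
        ≈⟨ ⋆-assoc S (twist ζ S) (X ⋆ twist ζ X) ⟨
      S ⋆ twist ζ S ⋆ (X ⋆ twist ζ X)
        ≈⟨ ⋆-interchange S (twist ζ S) X (twist ζ X) ⟩
      S ⋆ X ⋆ (twist ζ S ⋆ twist ζ X)
        ≈⟨ ⋆-cong (sinhProdCoeff-suc ω k t) (≋-trans (twist-cong ζ (sinhProdCoeff-suc ω k t)) (twist-distrib-⋆ ζ S X)) ⟨
      sinhProdCoeff R ω (suc k) t ⋆ twist ζ (sinhProdCoeff R ω (suc k) t)
        ∎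
      where
      ω : Carrier
      ω = ζ * ζ
      S X : Seq
      S = sinhCoeff ω t
      X = sinhProdCoeff R ω k (suc t)
      odd-factors : sinhCoeff ζ (suc (2 *ℕ t)) ≋ twist ζ S
      odd-factors = ≋-trans (≋-sym (twist-sinhCoeff ζ (2 *ℕ t))) (twist-cong ζ (sinhCoeff-square ζ t))

  -- Integral domains and roots of unity

  module _ (domain : IsIntegralDomain R) where
    open import Relation.Binary.Reasoning.Setoid setoid

    *-cancelˡ : ∀ {x y z} → ¬ x ≈ 0# → x * y ≈ x * z → y ≈ z
    *-cancelˡ {x} {y} {z} x≉0 xy≈xz =
      [ (λ x≈0 → ⊥-elim (x≉0 x≈0)) , x∙y⁻¹≈ε⇒x≈y y z ]′ (proj₂ domain x (y - z) x[y-z]≈0)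
      where
      x[y-z]≈0 : x * (y - z) ≈ 0#
      x[y-z]≈0 = trans (x[y-z]≈xy-xz x y z) (x≈y⇒x∙y⁻¹≈ε xy≈xz)

    square≈1⇒±1 : ∀ {x} → x * x ≈ 1# → x ≈ 1# ⊎ x ≈ - 1#
    square≈1⇒±1 {x} x²≈1 =
      [ (λ x-1≈0 → inj₁ (x∙y⁻¹≈ε⇒x≈y x 1# x-1≈0)) , (λ x+1≈0 → inj₂ (inverseˡ-unique x 1# x+1≈0)) ]′
        (proj₂ domain (x - 1#) (x + 1#) product≈0)
      where
      product≈0 : (x - 1#) * (x + 1#) ≈ 0#
      product≈0 = begin
        (x - 1#) * (x + 1#)          ≈⟨ [y-z]x≈yx-zx (x + 1#) x 1# ⟩
        x * (x + 1#) - 1# * (x + 1#) ≈⟨ +-cong x[x+1]≈x+1 (-‿cong (*-identityˡ _)) ⟩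
        (x + 1#) - (x + 1#)          ≈⟨ -‿inverseʳ _ ⟩
        0#                           ∎
        where
        x[x+1]≈x+1 : x * (x + 1#) ≈ x + 1#
        x[x+1]≈x+1 = trans (distribˡ x x 1#) (trans (+-cong x²≈1 (*-identityʳ x)) (+-comm 1# x))

    module _ {K ζ} (prim : IsPrimitiveRoot R K ζ) where

      primitiveRoot-^≈1 : ∀ {d} → d < K → ζ ^ d ≈ 1# → d ≡ 0
      primitiveRoot-^≈1 {zero}  _   _      = P.refl
      primitiveRoot-^≈1 {suc d} d<K ζ^d≈1 = ⊥-elim (proj₂ prim (suc d) ℕ.0<1+n d<K ζ^d≈1)

      primitiveRoot-^-injective-≤ : ∀ {a b} → a ≤ b → b < K → ζ ^ a ≈ ζ ^ b → a ≡ b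
      primitiveRoot-^-injective-≤ {a} {b} a≤b b<K ζ^a≈ζ^b =
        P.trans (P.sym (ℕ.+-identityʳ a)) (P.trans (P.cong (a +ℕ_) (P.sym d≡0)) (ℕ.m+[n∸m]≡n a≤b))
        where
        d : ℕ
        d = b ∸ a
        ζ^a≉0 : ¬ ζ ^ a ≈ 0#
        ζ^a≉0 ζ^a≈0 = proj₁ domain (begin
          1#                   ≈⟨ proj₁ prim ⟨
          ζ ^ K                ≡⟨ P.cong (ζ ^_) (ℕ.m+[n∸m]≡n (ℕ.<⇒≤ (ℕ.≤-<-trans a≤b b<K))) ⟨
          ζ ^ (a +ℕ (K ∸ a))   ≈⟨ ^-homo-* ζ a (K ∸ a) ⟩
          ζ ^ a * ζ ^ (K ∸ a)  ≈⟨ *-congʳ ζ^a≈0 ⟩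
          0# * ζ ^ (K ∸ a)     ≈⟨ zeroˡ _ ⟩
          0#                   ∎)
        ζ^d≈1 : ζ ^ d ≈ 1#
        ζ^d≈1 = *-cancelˡ ζ^a≉0 (begin
          ζ ^ a * ζ ^ d  ≈⟨ ^-homo-* ζ a d ⟨
          ζ ^ (a +ℕ d)   ≡⟨ P.cong (ζ ^_) (ℕ.m+[n∸m]≡n a≤b) ⟩
          ζ ^ b          ≈⟨ ζ^a≈ζ^b ⟨
          ζ ^ a          ≈⟨ *-identityʳ _ ⟨
          ζ ^ a * 1#     ∎)
        d≡0 : d ≡ 0
        d≡0 = primitiveRoot-^≈1 (ℕ.≤-<-trans (ℕ.m∸n≤m b a) b<K) ζ^d≈1

      primitiveRoot-^-injective : ∀ {a b} → a < K → b < K → ζ ^ a ≈ ζ ^ b → a ≡ b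
      primitiveRoot-^-injective {a} {b} a<K b<K ζ^a≈ζ^b with ℕ.≤-total a b
      ... | inj₁ a≤b = primitiveRoot-^-injective-≤ a≤b b<K ζ^a≈ζ^b
      ... | inj₂ b≤a = P.sym (primitiveRoot-^-injective-≤ b≤a a<K (sym ζ^a≈ζ^b))

    primitiveRoot-half : ∀ {M ζ} → IsPrimitiveRoot R (2 *ℕ M) ζ → 0 < M → ζ ^ M ≈ - 1#
    primitiveRoot-half {M} {ζ} prim 0<M =
      [ (λ ζ^M≈1 → ⊥-elim (proj₂ prim M 0<M (n<2*n 0<M) ζ^M≈1)) , id ]′ (square≈1⇒±1 ζ^M*ζ^M≈1)
      where
      ζ^M*ζ^M≈1 : ζ ^ M * ζ ^ M ≈ 1#
      ζ^M*ζ^M≈1 = begin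
        ζ ^ M * ζ ^ M  ≈⟨ ^-homo-* ζ M M ⟨
        ζ ^ (M +ℕ M)   ≡⟨ P.cong (λ k → ζ ^ (M +ℕ k)) (ℕ.+-identityʳ M) ⟨
        ζ ^ (2 *ℕ M)   ≈⟨ proj₁ prim ⟩
        1#             ∎

    sinhProdCoeff-vanishes : ∀ {ω K} → ω ^ K ≈ - 1# → 0 < K →
      ∀ T → sinhProdCoeff R ω K 0 T ≈ 0# ⊎ ω ^ T ≈ - 1#
    sinhProdCoeff-vanishes {ω} {K} ω^K≈-1 0<K T =
      [ (λ ω^T+1≈0 → inj₂ (inverseˡ-unique _ _ ω^T+1≈0)) , inj₁ ]′ (proj₂ domain (ω ^ T + 1#) (P T) product≈0)
      where
      P : Seq
      P = sinhProdCoeff R ω K 0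
      product≈0 : (ω ^ T + 1#) * P T ≈ 0#
      product≈0 = begin
        (ω ^ T + 1#) * P T      ≈⟨ distribʳ _ _ _ ⟩
        ω ^ T * P T + 1# * P T  ≈⟨ +-congʳ (twist-sinhProdCoeff-antiperiodic ω^K≈-1 0<K T) ⟩
        - 1# * P T + 1# * P T   ≈⟨ distribʳ _ _ _ ⟨
        (- 1# + 1#) * P T       ≈⟨ *-congʳ (-‿inverseˡ 1#) ⟩
        0# * P T                ≈⟨ zeroˡ _ ⟩
        0#                      ∎

    module _ {N ζ} (0<N : 0 < N) (prim : IsPrimitiveRoot R (4 *ℕ N) ζ) where
      private
        ω : Carrier
        ω = ζ * ζ

        A : Seq
        A = sinhProdCoeff R ω N 0

        prim′ : IsPrimitiveRoot R (2 *ℕ (2 *ℕ N)) ζ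
        prim′ = P.subst (λ K → IsPrimitiveRoot R K ζ) (ℕ.*-assoc 2 2 N) prim

        deg : ℕ → ℕ
        deg n = 2 *ℕ n *ℕ (2 *ℕ N) +ℕ 2 *ℕ N

        term : ℕ → ℕ → Carrier
        term n a = (deg n C a) × (A a * twist ζ A (deg n ∸ a))

        expansionTerm : ℕ → ℕ → Carrier
        expansionTerm n l =
          (- 1#) ^ l * ((4 *ℕ N *ℕ n +ℕ 2 *ℕ N) C (2 *ℕ N *ℕ l +ℕ N)) × (α R ω N (2 *ℕ n ∸ l) * α R ω N l)

      ζ^2N≈-1 : ζ ^ (2 *ℕ N) ≈ - 1#
      ζ^2N≈-1 = primitiveRoot-half prim′ (ℕ.*-monoʳ-< 2 0<N)

      sinhProdCoeff-support : ∀ q r → r < 2 *ℕ N → r ≢ N → A (q *ℕ (2 *ℕ N) +ℕ r) ≈ 0#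
      sinhProdCoeff-support q r r<2N r≢N =
        [ id , (λ ω^T≈-1 → ⊥-elim (r≢N (r≡N ω^T≈-1))) ]′ (sinhProdCoeff-vanishes ω^N≈-1 0<N T)
        where
        T : ℕ
        T = q *ℕ (2 *ℕ N) +ℕ r
        ω^N≈-1 : ω ^ N ≈ - 1#
        ω^N≈-1 = trans (^-square ζ N) ζ^2N≈-1
        double : ∀ q N r → 2 *ℕ (q *ℕ (2 *ℕ N) +ℕ r) ≡ q *ℕ (2 *ℕ (2 *ℕ N)) +ℕ 2 *ℕ r
        double = solve-∀
        r≡N : ω ^ T ≈ - 1# → r ≡ N
        r≡N ω^T≈-1 = ℕ.*-cancelˡ-≡ r N 2
          (primitiveRoot-^-injective prim′ (ℕ.*-monoʳ-< 2 r<2N) (ℕ.*-monoʳ-< 2 (n<2*n 0<N)) (begin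
            ζ ^ (2 *ℕ r)                           ≈⟨ ^-periodic (proj₁ prim′) q (2 *ℕ r) ⟨
            ζ ^ (q *ℕ (2 *ℕ (2 *ℕ N)) +ℕ 2 *ℕ r)  ≡⟨ P.cong (ζ ^_) (double q N r) ⟨
            ζ ^ (2 *ℕ T)                           ≈⟨ ^-square ζ T ⟨
            ω ^ T                                  ≈⟨ ω^T≈-1 ⟩
            - 1#                                   ≈⟨ ζ^2N≈-1 ⟨
            ζ ^ (2 *ℕ N)                           ∎))

      term-vanishes : ∀ n q r → r < 2 *ℕ N → r ≢ N → term n (q *ℕ (2 *ℕ N) +ℕ r) ≈ 0#
      term-vanishes n q r r<2N r≢N =
        trans (×-congʳ (deg n C a) (trans (*-congʳ (sinhProdCoeff-support q r r<2N r≢N)) (zeroˡ _)))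
              (×-zeroʳ (deg n C a))
        where
        a : ℕ
        a = q *ℕ (2 *ℕ N) +ℕ r

      ζ^[2dN+N]≈ζ^N*[-1]^q : ∀ {q d n} → q +ℕ d ≡ 2 *ℕ n → ζ ^ (2 *ℕ d *ℕ N +ℕ N) ≈ ζ ^ N * (- 1#) ^ q
      ζ^[2dN+N]≈ζ^N*[-1]^q {q} {d} {n} q+d≡2n = begin
        ζ ^ (2 *ℕ d *ℕ N +ℕ N)     ≈⟨ ^-homo-* ζ (2 *ℕ d *ℕ N) N ⟩
        ζ ^ (2 *ℕ d *ℕ N) * ζ ^ N  ≈⟨ *-comm _ _ ⟩
        ζ ^ N * ζ ^ (2 *ℕ d *ℕ N)  ≡⟨ P.cong (λ k → ζ ^ N * ζ ^ k) (2dN≡2Nd d N) ⟩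
        ζ ^ N * ζ ^ (2 *ℕ N *ℕ d)  ≈⟨ *-congˡ (^-assocʳ ζ (2 *ℕ N) d) ⟨
        ζ ^ N * (ζ ^ (2 *ℕ N)) ^ d ≈⟨ *-congˡ (^-congˡ d ζ^2N≈-1) ⟩
        ζ ^ N * (- 1#) ^ d         ≈⟨ *-congˡ (-1^n≈sign d) ⟩
        ζ ^ N * sign (parity d)    ≡⟨ P.cong (λ p → ζ ^ N * sign p) (parity-complement {q} {d} {n} q+d≡2n) ⟩
        ζ ^ N * sign (parity q)    ≈⟨ *-congˡ (-1^n≈sign q) ⟨
        ζ ^ N * (- 1#) ^ q         ∎
        where
        2dN≡2Nd : ∀ d N → 2 *ℕ d *ℕ N ≡ 2 *ℕ N *ℕ d
        2dN≡2Nd = solve-∀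

      term-survives : ∀ {n q} → q ≤ 2 *ℕ n → term n (q *ℕ (2 *ℕ N) +ℕ N) ≈ ζ ^ N * expansionTerm n q
      term-survives {n} {q} q≤2n = begin
        (deg n C a) × (A a * (ζ ^ (deg n ∸ a) * A (deg n ∸ a)))
          ≈⟨ ×-cong (P.cong₂ _C_ (deg≡ n N) (a≡ q N))
                    (*-cong (reflexive (P.cong A (a≡′ q N))) (reflexive (P.cong (twist ζ A) deg∸a≡))) ⟩
        (T₀ C b) × (α R ω N q * (ζ ^ (2 *ℕ d *ℕ N +ℕ N) * α R ω N d))
          ≈⟨ ×-congʳ (T₀ C b) (*-congˡ (*-congʳ (ζ^[2dN+N]≈ζ^N*[-1]^q {q} {d} {n} q+d≡2n))) ⟩
        (T₀ C b) × (α R ω N q * (ζ ^ N * (- 1#) ^ q * α R ω N d))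
          ≈⟨ ×-congʳ (T₀ C b) (rearrange _ _ _ _) ⟩
        (T₀ C b) × (ζ ^ N * ((- 1#) ^ q * (α R ω N d * α R ω N q)))
          ≈⟨ ×-comm-* (T₀ C b) _ _ ⟨
        ζ ^ N * (T₀ C b) × ((- 1#) ^ q * (α R ω N d * α R ω N q))
          ≈⟨ *-congˡ (×-comm-* (T₀ C b) _ _) ⟨
        ζ ^ N * expansionTerm n q
          ∎
        where
        a T₀ b d : ℕ
        a  = q *ℕ (2 *ℕ N) +ℕ N
        T₀ = 4 *ℕ N *ℕ n +ℕ 2 *ℕ N
        b  = 2 *ℕ N *ℕ q +ℕ N
        d  = 2 *ℕ n ∸ q
        q+d≡2n : q +ℕ d ≡ 2 *ℕ n
        q+d≡2n = ℕ.m+[n∸m]≡n q≤2n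
        deg≡ : ∀ n N → 2 *ℕ n *ℕ (2 *ℕ N) +ℕ 2 *ℕ N ≡ 4 *ℕ N *ℕ n +ℕ 2 *ℕ N
        deg≡ = solve-∀
        a≡ : ∀ q N → q *ℕ (2 *ℕ N) +ℕ N ≡ 2 *ℕ N *ℕ q +ℕ N
        a≡ = solve-∀
        a≡′ : ∀ q N → q *ℕ (2 *ℕ N) +ℕ N ≡ 2 *ℕ q *ℕ N +ℕ N
        a≡′ = solve-∀
        split : ∀ q d N → (q +ℕ d) *ℕ (2 *ℕ N) +ℕ 2 *ℕ N ≡ (q *ℕ (2 *ℕ N) +ℕ N) +ℕ (2 *ℕ d *ℕ N +ℕ N)
        split = solve-∀
        deg∸a≡ : deg n ∸ a ≡ 2 *ℕ d *ℕ N +ℕ N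
        deg∸a≡ = P.trans (P.cong (λ m → m *ℕ (2 *ℕ N) +ℕ 2 *ℕ N ∸ a) (P.sym q+d≡2n))
                 (P.trans (P.cong (_∸ a) (split q d N)) (ℕ.m+n∸m≡n a _))
        rearrange : ∀ x z s y → x * (z * s * y) ≈ z * (s * (y * x))
        rearrange x z s y = begin
          x * (z * s * y)    ≈⟨ *-comm _ _ ⟩
          z * s * y * x      ≈⟨ *-assoc _ _ _ ⟩
          z * s * (y * x)    ≈⟨ *-assoc _ _ _ ⟩
          z * (s * (y * x))  ∎

      α-expansion : ∀ n → α R ζ (2 *ℕ N) n ≈ ζ ^ N * sum (2 *ℕ n +ℕ 1) (expansionTerm n)
      α-expansion n = begin
        α R ζ (2 *ℕ N) n
          ≈⟨ sinhProdCoeff-even-odd ζ N 0 (deg n) ⟩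
        sum (deg n) (term n) + term n (deg n)
          ≈⟨ +-congˡ (trans (reflexive (P.cong (term n) deg≡blocks)) (term-vanishes n (2 *ℕ n +ℕ 1) 0 0<2N 0≢N)) ⟩
        sum (deg n) (term n) + 0#
          ≈⟨ +-identityʳ _ ⟩
        sum (deg n) (term n)
          ≡⟨ P.cong (λ k → sum k (term n)) (P.trans deg≡blocks (ℕ.+-identityʳ _)) ⟩
        sum ((2 *ℕ n +ℕ 1) *ℕ (2 *ℕ N)) (term n)
          ≈⟨ sum-* (2 *ℕ n +ℕ 1) (2 *ℕ N) (term n) ⟩
        sum (2 *ℕ n +ℕ 1) (λ q → sum (2 *ℕ N) (λ r → term n (q *ℕ (2 *ℕ N) +ℕ r)))
          ≈⟨ sum-cong (2 *ℕ n +ℕ 1) (λ q _ → sum-singleton (2 *ℕ N) _ N (n<2*n 0<N) (term-vanishes n q)) ⟩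
        sum (2 *ℕ n +ℕ 1) (λ q → term n (q *ℕ (2 *ℕ N) +ℕ N))
          ≈⟨ sum-cong (2 *ℕ n +ℕ 1) (λ q q<2n+1 → term-survives (q<2n+1⇒q≤2n q<2n+1)) ⟩
        sum (2 *ℕ n +ℕ 1) (λ q → ζ ^ N * expansionTerm n q)
          ≈⟨ *-distribˡ-sum (2 *ℕ n +ℕ 1) (ζ ^ N) (expansionTerm n) ⟨
        ζ ^ N * sum (2 *ℕ n +ℕ 1) (expansionTerm n)
          ∎
        where
        0<2N : 0 < 2 *ℕ N
        0<2N = ℕ.*-monoʳ-< 2 0<N
        0≢N : 0 ≢ N
        0≢N = ℕ.<⇒≢ 0<N
        q<2n+1⇒q≤2n : ∀ {q} → q < 2 *ℕ n +ℕ 1 → q ≤ 2 *ℕ n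
        q<2n+1⇒q≤2n {q} q<2n+1 = ℕ.m<1+n⇒m≤n (P.subst (q <_) (ℕ.+-comm (2 *ℕ n) 1) q<2n+1)
        blocks : ∀ n N → 2 *ℕ n *ℕ (2 *ℕ N) +ℕ 2 *ℕ N ≡ (2 *ℕ n +ℕ 1) *ℕ (2 *ℕ N) +ℕ 0
        blocks = solve-∀
        deg≡blocks : deg n ≡ (2 *ℕ n +ℕ 1) *ℕ (2 *ℕ N) +ℕ 0
        deg≡blocks = blocks n N

-- Opened only now: above, _+_ and _*_ are the ring operations.
open import Data.Nat using (ℕ; _+_; _*_; _∸_; _<_)
open CommutativeRing using (Carrier; _≈_; -_; 1#) renaming (_*_ to mulR)

theorem1 : ∀ {c ℓ : Level} (R : CommutativeRing c ℓ) → IsIntegralDomain R →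
    (N : ℕ) → 0 < N → (ζ : Carrier R) → IsPrimitiveRoot R (4 * N) ζ →
    (n : ℕ) →
    _≈_ R (α R ζ (2 * N) n)
      (mulR R (powR R ζ N)
        (sumR R (2 * n + 1)
          (λ l → mulR R (powR R (-_ R (1# R)) l)
                   (natMul R ((4 * N * n + 2 * N) C (2 * N * l + N))
                     (mulR R (α R (mulR R ζ ζ) N (2 * n ∸ l)) (α R (mulR R ζ ζ) N l))))))
theorem1 R domain N 0<N ζ prim = α-expansion R domain 0<N prim
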